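{- Let $n>1$ and let $S_n$ be an ideal aperiodic orientable sequence of order $n$ of length $\ell_n$. For $r\ge n$ define $S_{r+1}$ from $S_r$ (of order $r$ and length $\ell_r$) as follows: write $D^{ -1}(S_r)=\{T,\bar T\}$ with $T$ beginning with $r$ zeros, let $U=\bar T^R$; if $r$ is even, $S_{r+1}$ is $T$ followed by $U$ with its first $r$ bits removed; if $r$ is odd, $S_{r+1}$ is $T$ followed by $U$ with its first $r-1$ bits removed. (Each $S_r$ is an ideal aperiodic orientable sequence of order $r$.) Let $\ell_{m+n}$ be the length of $S_{m+n}$, $m\ge 0$. Then \[\ell_{m+n}=2^m(\ell_n-n+1)+x_m/3+m+n-1,\] where $x_m=2^m-1$ if $n$ and $m$ are both even; $x_m=2^m-2$ if $n$ is even and $m$ is odd; $x_m=2^{m+1}-2$ if $n$ is odd and $m$ is even; and $x_m=2^{m+1}-1$ if $n$ and $m$ are both odd.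
   Context: For a finite binary sequence $S=(s_0,\dots,s_{\ell-1})$, $\mathbf{s}_n(i)=(s_i,\dots,s_{i+n-1})$ for $0\le i\le\ell-n$; the reverse of a tuple or finite sequence $(u_0,\dots,u_{k-1})$ is $(u_{k-1},\dots,u_0)$, written with superscript $R$. $S$ is an aperiodic orientable sequence of order $n$ if the $2\ell-2n+2$ tuples $\mathbf{s}_n(i)$ and their reverses ($0\le i\le\ell-n$) are all distinct. It is ideal ($n>1$) if its first $n-1$ bits are all $0$ and its last $n-1$ bits are all $1$. The complement $\bar T$ swaps $0$ and $1$ in every position. Lempel map: $D(t_0,\dots,t_\ell)=(t_0\oplus t_1,\dots,t_{\ell-1}\oplus t_\ell)$ ($\oplus$ = addition mod 2); $D^{ -1}(S)$ is the set of binary sequences of length $\ell+1$ with $D(T)=S$. -}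

module Defs where

open import Data.Bool using (Bool; true; false; not; _xor_)
open import Data.Nat using (ℕ; zero; suc; _+_; _*_; _∸_; _^_; _<_)
open import Data.List using (List; []; _∷_; _++_; map; take; drop; length; reverse; replicate; upTo)
open import Data.List.Relation.Unary.Unique.Propositional using (Unique)
open import Data.Product using (_×_)
open import Relation.Binary.PropositionalEquality using (_≡_)

-- binary sequences are lists of Bool (false = 0, true = 1)

windows : ℕ → List Bool → List (List Bool)
windows n S = map (λ i → take n (drop i S)) (upTo (suc (length S) ∸ n))

AperiodicOrientable : ℕ → List Bool → Set
AperiodicOrientable n S = Unique (windows n S ++ map reverse (windows n S))

IdealAOS : ℕ → List Bool → Set
IdealAOS n S =
  (1 < n) × AperiodicOrientable n S
  × (take (n ∸ 1) S ≡ replicate (n ∸ 1) false)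
  × (drop (length S ∸ (n ∸ 1)) S ≡ replicate (n ∸ 1) true)

D : List Bool → List Bool
D [] = []
D (t ∷ []) = []
D (t ∷ u ∷ ts) = (t xor u) ∷ D (u ∷ ts)

-- the element of D^{-1}(S) whose first bit is b
Dinv : Bool → List Bool → List Bool
Dinv b [] = b ∷ []
Dinv b (s ∷ ss) = b ∷ Dinv (b xor s) ss

complement : List Bool → List Bool
complement = map not

isEven : ℕ → Bool
isEven zero = true
isEven (suc k) = not (isEven k)

cut : ℕ → ℕ
cut r with isEven r
... | true = r
... | false = r ∸ 1

-- S_{r+1} from S_r: T is the preimage starting with 0 (hence with r zeros), U = (T̄)^R
step : ℕ → List Bool → List Bool
step r S = T ++ drop (cut r) (reverse (complement T))
  where T = Dinv false S

-- seqS n S m = S_{m+n}, starting from S_n = S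
seqS : ℕ → List Bool → ℕ → List Bool
seqS n S zero = S
seqS n S (suc m) = step (m + n) (seqS n S m)

x : ℕ → ℕ → ℕ
x n m with isEven n | isEven m
... | true  | true  = 2 ^ m ∸ 1
... | true  | false = 2 ^ m ∸ 2
... | false | true  = 2 ^ (suc m) ∸ 2
... | false | false = 2 ^ (suc m) ∸ 1

{-# OPTIONS --safe #-}
-- Each step roughly doubles the length: |S_{r+1}| = 2(|S_r| + 1) − cut r.  Measuring the
-- excess A_r = |S_r| − (r − 1) over the minimal length, this reads A_{r+1} = 2 A_r + [r odd],
-- so A_{n+m} = 2^m A_n + c_m with c_{m+1} = 2 c_m + [m + n odd]; the four parity cases of
-- x n m are exactly 3 c_m, which is checked by induction on m.
module Submission where

open import Defs
open import Data.Nat using (ℕ; zero; suc; _+_; _*_; _∸_; _^_; _/_; _≤_; _<_; _≤?_; s≤s)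
open import Data.Nat.Properties
  using (+-suc; +-assoc; +-comm; +-identityʳ; *-comm; *-identityˡ; *-distribˡ-+; m+n∸n≡m; m∸n+n≡m; m≤n⇒m∸n≡0; ≰⇒>)
open import Data.Nat.DivMod using (m*n/n≡m)
open import Data.Nat.Tactic.RingSolver using (solve-∀)
open import Data.Bool using (Bool; true; false; not; _xor_; if_then_else_)
open import Data.List using (List; []; _∷_; _++_; length; take; drop; replicate; reverse; map)
open import Data.List.Properties using (length-++; length-drop; length-reverse; length-map)
open import Data.Product using (_,_)
open import Relation.Nullary using (yes; no; contradiction)
open import Relation.Binary.PropositionalEquality
  using (_≡_; refl; sym; trans; cong; cong₂; subst; module ≡-Reasoning)

open ≡-Reasoning

isEven-+ : ∀ m n → isEven (m + n) ≡ not (isEven m) xor isEven n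
isEven-+ zero    n = refl
isEven-+ (suc m) n rewrite isEven-+ m n with isEven m | isEven n
... | true  | true  = refl
... | true  | false = refl
... | false | true  = refl
... | false | false = refl

oddBit : ℕ → ℕ
oddBit n = if isEven n then 0 else 1

length-Dinv : ∀ b S → length (Dinv b S) ≡ suc (length S)
length-Dinv b []       = refl
length-Dinv b (s ∷ ss) = cong suc (length-Dinv (b xor s) ss)

length-step : ∀ r S → length (step r S) ≡ suc (length S) + (suc (length S) ∸ cut r)
length-step r S = begin
  length (T ++ drop (cut r) (reverse (map not T)))         ≡⟨ length-++ T ⟩
  length T + length (drop (cut r) (reverse (map not T)))  ≡⟨ cong (length T +_) (length-drop (cut r) _) ⟩
  length T + (length (reverse (map not T)) ∸ cut r)       ≡⟨ cong (λ l → length T + (l ∸ cut r)) reversed ⟩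
  length T + (length T ∸ cut r)                           ≡⟨ cong (λ l → l + (l ∸ cut r)) (length-Dinv false S) ⟩
  suc (length S) + (suc (length S) ∸ cut r)               ∎
  where
  T : List Bool
  T = Dinv false S
  reversed : length (reverse (map not T)) ≡ length T
  reversed = trans (length-reverse (map not T)) (length-map not T)

suc-∸-cut : ∀ A k → suc (A + k) ∸ cut (suc k) ≡ A + oddBit (suc k)
suc-∸-cut A k with isEven (suc k)
... | true  = begin
  suc (A + k) ∸ suc k  ≡⟨ cong (_∸ suc k) (sym (+-suc A k)) ⟩
  A + suc k ∸ suc k    ≡⟨ m+n∸n≡m A (suc k) ⟩
  A                    ≡⟨ sym (+-identityʳ A) ⟩
  A + 0                ∎
... | false = trans (m+n∸n≡m (suc A) k) (+-comm 1 A)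

length-step-excess : ∀ k A S → length S ≡ A + k →
  length (step (suc k) S) ≡ 2 * A + oddBit (suc k) + suc k
length-step-excess k A S ℓ≡A+k = begin
  length (step (suc k) S)                              ≡⟨ length-step (suc k) S ⟩
  suc (length S) + (suc (length S) ∸ cut (suc k))      ≡⟨ cong (λ ℓ → suc ℓ + (suc ℓ ∸ cut (suc k))) ℓ≡A+k ⟩
  suc (A + k) + (suc (A + k) ∸ cut (suc k))            ≡⟨ cong (suc (A + k) +_) (suc-∸-cut A k) ⟩
  suc (A + k) + (A + oddBit (suc k))                   ≡⟨ rearrange A k (oddBit (suc k)) ⟩
  2 * A + oddBit (suc k) + suc k                       ∎
  where
  rearrange : ∀ a k o → suc (a + k) + (a + o) ≡ 2 * a + o + suc k
  rearrange = solve-∀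

carry : ℕ → ℕ → ℕ
carry n zero    = 0
carry n (suc m) = 2 * carry n m + oddBit (m + n)

length-seqS : ∀ n' A S → length S ≡ A + n' → ∀ m →
  length (seqS (suc n') S m) ≡ 2 ^ m * A + carry (suc n') m + (m + n')
length-seqS n' A S ℓ≡A+n' zero = trans ℓ≡A+n' (initial A n')
  where
  initial : ∀ a k → a + k ≡ 1 * a + 0 + k
  initial = solve-∀
length-seqS n' A S ℓ≡A+n' (suc m) rewrite +-suc m n' = begin
  length (step (suc (m + n')) (seqS (suc n') S m))
    ≡⟨ length-step-excess (m + n') (2 ^ m * A + carry (suc n') m) (seqS (suc n') S m)
        (length-seqS n' A S ℓ≡A+n' m) ⟩
  2 * (2 ^ m * A + carry (suc n') m) + o + suc (m + n')
    ≡⟨ rearrange (2 ^ m) A (carry (suc n') m) o (m + n') ⟩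
  2 * 2 ^ m * A + (2 * carry (suc n') m + o) + suc (m + n')
    ∎
  where
  o : ℕ
  o = oddBit (suc (m + n'))
  rearrange : ∀ p a c o k → 2 * (p * a + c) + o + suc k ≡ 2 * p * a + (2 * c + o) + suc k
  rearrange = solve-∀

xLead : Bool → ℕ
xLead true  = 1
xLead false = 2

xOffset : Bool → Bool → ℕ
xOffset true  true  = 1
xOffset true  false = 2
xOffset false true  = 2
xOffset false false = 1

x≡lead-offset : ∀ n m → x n m ≡ xLead (isEven n) * 2 ^ m ∸ xOffset (isEven n) (isEven m)
x≡lead-offset n m with isEven n | isEven m
... | true  | true  = cong (_∸ 1) (sym (*-identityˡ (2 ^ m)))
... | true  | false = cong (_∸ 2) (sym (*-identityˡ (2 ^ m)))
... | false | true  = refl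
... | false | false = refl

xOffset-suc : ∀ n m →
  3 * oddBit (m + n) + xOffset (isEven n) (isEven (suc m)) ≡ 2 * xOffset (isEven n) (isEven m)
xOffset-suc n m =
  trans (cong (λ b → 3 * (if b then 0 else 1) + xOffset (isEven n) (isEven (suc m))) (isEven-+ m n))
        (byCases (isEven n) (isEven m))
  where
  byCases : ∀ p q → 3 * (if not q xor p then 0 else 1) + xOffset p (not q) ≡ 2 * xOffset p q
  byCases true  true  = refl
  byCases true  false = refl
  byCases false true  = refl
  byCases false false = refl

3*carry+xOffset : ∀ n m → 3 * carry n m + xOffset (isEven n) (isEven m) ≡ xLead (isEven n) * 2 ^ m
3*carry+xOffset n zero with isEven n
... | true  = refl
... | false = refl
3*carry+xOffset n (suc m) = begin
  3 * (2 * c + o) + xOffset p (isEven (suc m))     ≡⟨ regroup c o (xOffset p (isEven (suc m))) ⟩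
  2 * (3 * c) + (3 * o + xOffset p (isEven (suc m))) ≡⟨ cong (2 * (3 * c) +_) (xOffset-suc n m) ⟩
  2 * (3 * c) + 2 * xOffset p (isEven m)          ≡⟨ sym (*-distribˡ-+ 2 (3 * c) (xOffset p (isEven m))) ⟩
  2 * (3 * c + xOffset p (isEven m))              ≡⟨ cong (2 *_) (3*carry+xOffset n m) ⟩
  2 * (xLead p * 2 ^ m)                           ≡⟨ doubleʳ (xLead p) (2 ^ m) ⟩
  xLead p * 2 ^ suc m                             ∎
  where
  p : Bool
  p = isEven n
  c o : ℕ
  c = carry n m
  o = oddBit (m + n)
  regroup : ∀ c o d → 3 * (2 * c + o) + d ≡ 2 * (3 * c) + (3 * o + d)
  regroup = solve-∀
  doubleʳ : ∀ a b → 2 * (a * b) ≡ a * (2 * b)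
  doubleʳ = solve-∀

x/3≡carry : ∀ n m → x n m / 3 ≡ carry n m
x/3≡carry n m = begin
  x n m / 3                      ≡⟨ cong (_/ 3) (x≡lead-offset n m) ⟩
  (xLead p * 2 ^ m ∸ d) / 3      ≡⟨ cong (λ t → (t ∸ d) / 3) (sym (3*carry+xOffset n m)) ⟩
  (3 * carry n m + d ∸ d) / 3    ≡⟨ cong (_/ 3) (m+n∸n≡m (3 * carry n m) d) ⟩
  3 * carry n m / 3              ≡⟨ cong (_/ 3) (*-comm 3 (carry n m)) ⟩
  carry n m * 3 / 3              ≡⟨ m*n/n≡m (carry n m) 3 ⟩
  carry n m                      ∎
  where
  p : Bool
  p = isEven n
  d : ℕ
  d = xOffset p (isEven m)

zeros-ones-length : ∀ k (S : List Bool) → take (suc k) S ≡ replicate (suc k) false →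
  drop (length S ∸ suc k) S ≡ replicate (suc k) true → suc k < length S
zeros-ones-length k S zeros ones with length S ≤? suc k
... | no  ℓ≰k = ≰⇒> ℓ≰k
... | yes ℓ≤k = contradiction (trans (sym zeros) (cong (take (suc k)) S≡ones)) λ ()
  where
  S≡ones : S ≡ replicate (suc k) true
  S≡ones = subst (λ i → drop i S ≡ replicate (suc k) true) (m≤n⇒m∸n≡0 ℓ≤k) ones

-- The ideal condition is used only here, to make the truncated `length S ∸ n` honest.
ideal-length : ∀ {n S} → IdealAOS n S → n ≤ length S
ideal-length {zero}          (() , _)
ideal-length {suc zero}      (s≤s () , _)
ideal-length {suc (suc k)} {S} (_ , _ , zeros , ones) = zeros-ones-length k S zeros ones

lemma4 : (n : ℕ) (S : List Bool) → IdealAOS n S → (m : ℕ) →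
    length (seqS n S m) ≡ 2 ^ m * (length S ∸ n + 1) + x n m / 3 + (m + n ∸ 1)
lemma4 zero     S (() , _) m
lemma4 (suc n') S ideal    m = begin
  length (seqS (suc n') S m)                         ≡⟨ length-seqS n' A S ℓ≡A+n' m ⟩
  2 ^ m * A + carry (suc n') m + (m + n')            ≡⟨ cong₂ (λ c k → 2 ^ m * A + c + k)
                                                          (sym (x/3≡carry (suc n') m))
                                                          (cong (_∸ 1) (sym (+-suc m n'))) ⟩
  2 ^ m * A + x (suc n') m / 3 + (m + suc n' ∸ 1)    ∎
  where
  A : ℕ
  A = length S ∸ suc n' + 1
  ℓ≡A+n' : length S ≡ A + n'
  ℓ≡A+n' = sym (trans (+-assoc (length S ∸ suc n') 1 n') (m∸n+n≡m (ideal-length ideal)))
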